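{- Let $m\ge 1$ and let $\mathcal{D}$ be a symmetric SDP design, i.e. a symmetric $2$-$(2^{2m},2^{2m-1}-2^{m-1},2^{2m-2}-2^{m-1})$ design such that the symmetric difference of any three blocks is either a block or the complement of a block. Then for every block $B$ of $\mathcal{D}$, the residual design $\mathcal{D}_B$ is linearly embeddable over $GF(2)$.
   Context: A $2$-$(v,k,\lambda)$ design has $v$ points, blocks of size $k$, and every pair of points lies in exactly $\lambda$ blocks; it is symmetric if the number of blocks equals $v$. For a block $B$ of a design $\mathcal{D}=(X,\mathcal{B})$, the residual design $\mathcal{D}_B$ has point set $X\setminus B$ and blocks $B_j\setminus B$ for all blocks $B_j\ne B$. $\mathcal{D}_B$ is linearly embeddable over $GF(p)$ if $\mathrm{rank}_p A=\mathrm{rank}_p A''+1$, where $A$, $A''$ are the point-by-block incidence matrices of $\mathcal{D}$ and $\mathcal{D}_B$ and $\mathrm{rank}_p$ is rank over $GF(p)$. -}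

module Defs where

open import Data.Nat using (ℕ; zero; suc; _+_; _∸_; _^_; _*_)
open import Data.Bool using (Bool; true; false; _∧_; _xor_; not; if_then_else_)
open import Data.Fin using (Fin; zero; suc)
open import Data.Sum using (_⊎_)
open import Data.Product using (Σ; ∃; _×_; _,_)
open import Relation.Binary.PropositionalEquality using (_≡_; _≢_)
open import Relation.Nullary using (¬_)

-- A design on points Fin v with blocks indexed by Fin b is given by its
-- point-by-block incidence matrix over GF(2) = Bool: I x j = true iff x ∈ B_j.
Incidence : ℕ → ℕ → Set
Incidence v b = Fin v → Fin b → Bool

card : ∀ {n} → (Fin n → Bool) → ℕ
card {zero} f = 0
card {suc n} f = (if f zero then 1 else 0) + card (λ i → f (suc i))

sum₂ : ∀ {r} → (Fin r → Bool) → Bool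
sum₂ {zero} f = false
sum₂ {suc r} f = f zero xor sum₂ (λ i → f (suc i))

Is2Design : ∀ {v b} → Incidence v b → ℕ → ℕ → Set
Is2Design {v} {b} I k lam =
  (∀ (j : Fin b) → card (λ x → I x j) ≡ k) ×
  (∀ (x y : Fin v) → x ≢ y → card (λ j → I x j ∧ I y j) ≡ lam)

SDPCondition : ∀ {v b} → Incidence v b → Set
SDPCondition {v} {b} I =
  ∀ (j₁ j₂ j₃ : Fin b) →
    (Σ (Fin b) λ j → ∀ (x : Fin v) → (I x j₁ xor I x j₂ xor I x j₃) ≡ I x j)
    ⊎ (Σ (Fin b) λ j → ∀ (x : Fin v) → (I x j₁ xor I x j₂ xor I x j₃) ≡ not (I x j))

IsSymmetricSDP : (m : ℕ) → Incidence (2 ^ (2 * m)) (2 ^ (2 * m)) → Set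
IsSymmetricSDP m I =
  Is2Design I (2 ^ (2 * m ∸ 1) ∸ 2 ^ (m ∸ 1)) (2 ^ (2 * m ∸ 2) ∸ 2 ^ (m ∸ 1))
  × SDPCondition I

ColsIndependent : ∀ {R C : Set} → (R → C → Bool) → ∀ {r} → (Fin r → C) → Set
ColsIndependent {R} A {r} cols =
  ∀ (c : Fin r → Bool) →
    (∀ (x : R) → sum₂ (λ i → c i ∧ A x (cols i)) ≡ false) →
    ∀ (i : Fin r) → c i ≡ false

HasRank₂ : ∀ {R C : Set} → (R → C → Bool) → ℕ → Set
HasRank₂ {R} {C} A r =
  (Σ (Fin r → C) λ cols → ColsIndependent A cols) ×
  (∀ (cols : Fin (suc r) → C) → ¬ ColsIndependent A cols)

-- Incidence matrix A'' of the residual design D_B with respect to block B: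
-- points are the points not in B, blocks are B_j \ B for j ≠ B.
ResidualIncidence : ∀ {v b} → (I : Incidence v b) → (B : Fin b) →
  Σ (Fin v) (λ x → I x B ≡ false) → Σ (Fin b) (λ j → j ≢ B) → Bool
ResidualIncidence I B (x , _) (j , _) = I x j

LinearlyEmbeddable₂ : ∀ {v b} → Incidence v b → Fin b → Set
LinearlyEmbeddable₂ I B =
  ∀ (r r'' : ℕ) → HasRank₂ I r → HasRank₂ (ResidualIncidence I B) r'' →
    r ≡ r'' + 1

module Submission where

-- Over GF(2), every combination of columns of a symmetric SDP design has the form C + φ(B) for a
-- single block C and an affine φ : Bool → Bool: adding a further column D replaces C by the block
-- (or block complement) B + C + D.  If such a combination vanishes outside B, then C is constant
-- outside B.  As blocks have k points and 2k < v, C cannot contain the complement of B, so C ⊆ B and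
-- hence C = B; the combination is 0 or B.  So restricting the column space of A to the points
-- outside B has kernel {0, B}, which gives rank₂ A = rank₂ A'' + 1: appending B to independent
-- residual columns keeps them independent, and from r + 2 independent columns of A one can delete a
-- column (a pivot of the kernel) leaving r + 1 columns that are independent on the residual design.

open import Defs
open import Algebra.Bundles using (CommutativeRing)
open import Data.Bool using (Bool; true; false; not; _∧_; _xor_)
open import Data.Bool.Properties
  using ( xor-∧-commutativeRing; xor-same; xor-assoc; xor-comm; xor-identityʳ
        ; xor-annihilates-not; ∧-distribʳ-xor; ∧-identityʳ; ∧-zeroʳ; not-involutive; ¬-not)
open import Data.Empty using (⊥-elim)
open import Data.Fin using (Fin; zero; suc; punchIn)
open import Data.Fin.Properties using (punchInᵢ≢i)
open import Data.Nat using (ℕ; zero; suc; _+_; _∸_; _^_; _*_; _≤_; _<_; _≤′_; z≤n; s≤s; ≤′-refl; ≤′-step)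
open import Data.Nat.Properties
  using ( <-cmp; ≤⇒≤′; +-comm; +-suc; +-identityʳ; +-monoˡ-≤; +-mono-<; <⇒≢; <⇒≱
        ; <⇒≤; m≤n⇒m≤1+n; m<n⇒m<1+n; m<m+n; ^-monoʳ-<; m^n>0; ∸-monoʳ-<; m<n⇒0<n∸m; module ≤-Reasoning)
open import Data.Product using (Σ; _,_; proj₁; proj₂)
open import Data.Sum using (_⊎_; inj₁; inj₂)
import Data.Sum as Sum
open import Data.Vec.Functional using (_∷_; tail; removeAt; insertAt; updateAt)
open import Data.Vec.Functional.Properties
  using (updateAt-updates; updateAt-minimal; insertAt-lookup; insertAt-punchIn)
open import Function using (_∘_)
open import Relation.Binary.Definitions using (tri<; tri≈; tri>)
open import Relation.Binary.PropositionalEquality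
  using (_≡_; _≢_; _≗_; refl; sym; trans; cong; cong₂; subst; module ≡-Reasoning)
open import Relation.Nullary using (¬_; contradiction)

open CommutativeRing xor-∧-commutativeRing using (+-commutativeMonoid)
open import Algebra.Properties.CommutativeMonoid.Sum +-commutativeMonoid
  using (sum; sum-cong-≗; sum-remove; ∑-distrib-+)

sum₂≡sum : ∀ {r} (f : Fin r → Bool) → sum₂ f ≡ sum f
sum₂≡sum {zero}  f = refl
sum₂≡sum {suc r} f = cong (f zero xor_) (sum₂≡sum (tail f))

sum₂-cong : ∀ {r} {f g : Fin r → Bool} → f ≗ g → sum₂ f ≡ sum₂ g
sum₂-cong {f = f} {g} f≗g = begin
  sum₂ f ≡⟨ sum₂≡sum f ⟩
  sum f  ≡⟨ sum-cong-≗ f≗g ⟩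
  sum g  ≡⟨ sum₂≡sum g ⟨
  sum₂ g ∎
  where open ≡-Reasoning

sum₂-xor : ∀ {r} (f g : Fin r → Bool) → sum₂ (λ i → f i xor g i) ≡ sum₂ f xor sum₂ g
sum₂-xor f g = begin
  sum₂ (λ i → f i xor g i) ≡⟨ sum₂≡sum (λ i → f i xor g i) ⟩
  sum (λ i → f i xor g i)  ≡⟨ ∑-distrib-+ f g ⟩
  sum f xor sum g          ≡⟨ cong₂ _xor_ (sum₂≡sum f) (sum₂≡sum g) ⟨
  sum₂ f xor sum₂ g        ∎
  where open ≡-Reasoning

sum₂-removeAt : ∀ {r} (f : Fin (suc r) → Bool) i → sum₂ f ≡ f i xor sum₂ (removeAt f i)
sum₂-removeAt f i = begin
  sum₂ f                      ≡⟨ sum₂≡sum f ⟩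
  sum f                       ≡⟨ sum-remove {i = i} f ⟩
  f i xor sum (removeAt f i)  ≡⟨ cong (f i xor_) (sum₂≡sum (removeAt f i)) ⟨
  f i xor sum₂ (removeAt f i) ∎
  where open ≡-Reasoning

sum₂-false : ∀ {r} {f : Fin r → Bool} → (∀ i → f i ≡ false) → sum₂ f ≡ false
sum₂-false {zero}  _      = refl
sum₂-false {suc r} f≡false rewrite f≡false zero = sum₂-false (f≡false ∘ suc)

xor≡false⇒≡ : ∀ {a b} → a xor b ≡ false → a ≡ b
xor≡false⇒≡ {false} {false} _ = refl
xor≡false⇒≡ {true}  {true}  _ = refl

xor-xor-cancelˡ : ∀ a x y → (a xor x) xor (a xor y) ≡ x xor y
xor-xor-cancelˡ false x y = refl
xor-xor-cancelˡ true  x y = xor-annihilates-not x y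

combination : ∀ {R C : Set} → (R → C → Bool) → ∀ {n} → (Fin n → C) → (Fin n → Bool) → R → Bool
combination A cols c x = sum₂ (λ i → c i ∧ A x (cols i))

module _ {R C : Set} (A : R → C → Bool) where

  combination-cong : ∀ {n} (cols : Fin n → C) {c c'} → c ≗ c' → ∀ x →
    combination A cols c x ≡ combination A cols c' x
  combination-cong cols c≗c' x = sum₂-cong (λ i → cong (_∧ A x (cols i)) (c≗c' i))

  combination-xor : ∀ {n} (cols : Fin n → C) c c' x →
    combination A cols (λ i → c i xor c' i) x ≡ combination A cols c x xor combination A cols c' x
  combination-xor cols c c' x =
    trans (sum₂-cong (λ i → ∧-distribʳ-xor (A x (cols i)) (c i) (c' i)))
          (sum₂-xor (λ i → c i ∧ A x (cols i)) (λ i → c' i ∧ A x (cols i)))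

  combination-removeAt : ∀ {n} (cols : Fin (suc n) → C) {c} i → c i ≡ false → ∀ x →
    combination A cols c x ≡ combination A (removeAt cols i) (removeAt c i) x
  combination-removeAt cols {c} i cᵢ≡false x =
    trans (sum₂-removeAt (λ j → c j ∧ A x (cols j)) i)
          (cong (λ γ → (γ ∧ A x (cols i)) xor combination A (removeAt cols i) (removeAt c i) x) cᵢ≡false)

  unitVector : ∀ {n} → Fin n → Fin n → Bool
  unitVector l = updateAt (λ _ → false) l (λ _ → true)

  combination-unitVector : ∀ {n} (cols : Fin n → C) l x →
    combination A cols (unitVector l) x ≡ A x (cols l)
  combination-unitVector {suc n} cols l x = begin
    combination A cols (unitVector l) x
      ≡⟨ sum₂-removeAt (λ j → unitVector l j ∧ A x (cols j)) l ⟩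
    (unitVector l l ∧ A x (cols l)) xor sum₂ (λ j → unitVector l (punchIn l j) ∧ A x (cols (punchIn l j)))
      ≡⟨ cong₂ (λ γ s → (γ ∧ A x (cols l)) xor s) (updateAt-updates l (λ _ → false)) (sum₂-false off-l) ⟩
    A x (cols l) xor false
      ≡⟨ xor-identityʳ _ ⟩
    A x (cols l) ∎
    where
    open ≡-Reasoning
    off-l : ∀ j → unitVector l (punchIn l j) ∧ A x (cols (punchIn l j)) ≡ false
    off-l j = cong (_∧ A x (cols (punchIn l j)))
                   (updateAt-minimal (punchIn l j) l (λ _ → false) (punchInᵢ≢i l j))

  Independent : ℕ → Set
  Independent n = Σ (Fin n → C) (ColsIndependent A)

  ColsIndependent-tail : ∀ {n} {cols : Fin (suc n) → C} →
    ColsIndependent A cols → ColsIndependent A (tail cols)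
  ColsIndependent-tail ind c comb≡0 i = ind (false ∷ c) comb≡0 (suc i)

  Independent-mono : ∀ {m n} → m ≤′ n → Independent n → Independent m
  Independent-mono ≤′-refl           fam          = fam
  Independent-mono (≤′-step m≤′n) (cols , ind) =
    Independent-mono m≤′n (tail cols , ColsIndependent-tail {cols = cols} ind)

rank₂-≡-suc : ∀ {R C R'' C'' : Set} (A : R → C → Bool) (A'' : R'' → C'' → Bool) →
  (∀ {n} → Independent A'' n → Independent A (suc n)) →
  (∀ {n} → Independent A (suc (suc n)) → ¬ ¬ Independent A'' (suc n)) →
  ∀ {r r''} → HasRank₂ A r → HasRank₂ A'' r'' → r ≡ r'' + 1
rank₂-≡-suc A A'' extend restrict {r} {r''} (indA , maxA) (indA'' , maxA'') with <-cmp r (suc r'')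
... | tri≈ _ r≡ _ = trans r≡ (+-comm 1 r'')
... | tri< r< _ _ = contradiction (proj₂ larger) (maxA (proj₁ larger))
  where larger = Independent-mono A (≤⇒≤′ r<) (extend indA'')
... | tri> _ _ r> = ⊥-elim (restrict (Independent-mono A (≤⇒≤′ r>) indA) λ (cols , ind) → maxA'' cols ind)

VanishesOff : ∀ {v b} → Incidence v b → Fin b → (Fin v → Bool) → Set
VanishesOff I B f = ∀ x → I x B ≡ false → f x ≡ false

ZeroOrColumn : ∀ {v b} → Incidence v b → Fin b → (Fin v → Bool) → Set
ZeroOrColumn I B f = (∀ x → f x ≡ false) ⊎ (∀ x → f x ≡ I x B)

VanishingCombinationsZeroOrColumn : ∀ {v b} → Incidence v b → Fin b → Set
VanishingCombinationsZeroOrColumn {b = b} I B =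
  ∀ {n} (cols : Fin n → Fin b) c →
    VanishesOff I B (combination I cols c) → ZeroOrColumn I B (combination I cols c)

module _ {v b} (I : Incidence v b) (B : Fin b) where

  residual-extend : ∀ {x₀} → I x₀ B ≡ true →
    ∀ {n} → Independent (ResidualIncidence I B) n → Independent I (suc n)
  residual-extend {x₀} x₀∈B (cols'' , ind'') = cols , ind
    where
    open ≡-Reasoning
    cols = B ∷ proj₁ ∘ cols''

    tail≡false : ∀ c → (∀ x → combination I cols c x ≡ false) → ∀ l → c (suc l) ≡ false
    tail≡false c comb≡0 = ind'' (tail c) λ (x , x∉B) → trans (sym (drop-head x x∉B)) (comb≡0 x)
      where
      drop-head : ∀ x → I x B ≡ false → combination I cols c x ≡ combination I (tail cols) (tail c) x
      drop-head x x∉B = begin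
        (c zero ∧ I x B) xor rest ≡⟨ cong (λ β → (c zero ∧ β) xor rest) x∉B ⟩
        (c zero ∧ false) xor rest ≡⟨ cong (_xor rest) (∧-zeroʳ (c zero)) ⟩
        rest                      ∎
        where rest = combination I (tail cols) (tail c) x

    ind : ColsIndependent I cols
    ind c comb≡0 (suc l) = tail≡false c comb≡0 l
    ind c comb≡0 zero    = begin
      c zero                    ≡⟨ ∧-identityʳ (c zero) ⟨
      c zero ∧ true             ≡⟨ xor-identityʳ _ ⟨
      (c zero ∧ true) xor false ≡⟨ cong₂ (λ β s → (c zero ∧ β) xor s) x₀∈B tail-sum≡0 ⟨
      combination I cols c x₀   ≡⟨ comb≡0 x₀ ⟩
      false                     ∎
      where
      tail-sum≡0 : combination I (tail cols) (tail c) x₀ ≡ false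
      tail-sum≡0 = sum₂-false (λ l → cong (_∧ I x₀ (tail cols l)) (tail≡false c comb≡0 l))

  module ResidualRestriction (zero-or-B : VanishingCombinationsZeroOrColumn I B)
    {n} (cols : Fin (suc n) → Fin b) (ind : ColsIndependent I cols) where

    InKernel : (Fin (suc n) → Bool) → Set
    InKernel c = VanishesOff I B (combination I cols c)

    InKernel⇒≡B : ∀ {i} c → InKernel c → c i ≡ true → ∀ x → combination I cols c x ≡ I x B
    InKernel⇒≡B {i} c c∈K cᵢ≡true with zero-or-B cols c c∈K
    ... | inj₁ comb≡0 = contradiction (trans (sym cᵢ≡true) (ind c comb≡0 i)) λ ()
    ... | inj₂ comb≡B = comb≡B

    InKernel-unique : ∀ {i j} c c' → InKernel c → InKernel c' → c i ≡ true → c' j ≡ true → c ≗ c'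
    InKernel-unique c c' c∈K c'∈K cᵢ≡true c'ⱼ≡true l =
      xor≡false⇒≡ (ind (λ l → c l xor c' l) difference≡0 l)
      where
      open ≡-Reasoning
      difference≡0 : ∀ x → combination I cols (λ l → c l xor c' l) x ≡ false
      difference≡0 x = begin
        combination I cols (λ l → c l xor c' l) x
          ≡⟨ combination-xor I cols c c' x ⟩
        combination I cols c x xor combination I cols c' x
          ≡⟨ cong₂ _xor_ (InKernel⇒≡B c c∈K cᵢ≡true x) (InKernel⇒≡B c' c'∈K c'ⱼ≡true x) ⟩
        I x B xor I x B
          ≡⟨ xor-same (I x B) ⟩
        false ∎

    IsPivot : Fin (suc n) → Set
    IsPivot i = ∀ c → InKernel c → c i ≡ false → ∀ j → c j ≡ false

    InKernel⇒IsPivot : ∀ {i} c → InKernel c → c i ≡ true → IsPivot i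
    InKernel⇒IsPivot {i} c c∈K cᵢ≡true c' c'∈K c'ᵢ≡false j = ¬-not λ c'ⱼ≡true →
      contradiction (trans (sym cᵢ≡true) (trans (InKernel-unique c c' c∈K c'∈K cᵢ≡true c'ⱼ≡true i) c'ᵢ≡false))
                    λ ()

    -- Were no index a pivot, the kernel would contain no nonzero vector, and then every index is one.
    pivot-exists : ¬ ¬ Σ (Fin (suc n)) IsPivot
    pivot-exists no-pivot = no-pivot (zero , λ c c∈K _ j → ¬-not λ cⱼ≡true →
      no-pivot (j , InKernel⇒IsPivot c c∈K cⱼ≡true))


    residual-removeAt : ∀ {i} → IsPivot i → Independent (ResidualIncidence I B) n
    residual-removeAt {i} pivot = residual-cols , residual-ind
      where
      open ≡-Reasoning

      column≢B : ∀ l → cols (punchIn i l) ≢ B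
      column≢B l colⱼ≡B =
        contradiction (trans (sym (updateAt-updates j (λ _ → false))) (pivot eⱼ eⱼ∈K eⱼ,ᵢ≡false j)) λ ()
        where
        j = punchIn i l
        eⱼ = unitVector I j
        eⱼ∈K : InKernel eⱼ
        eⱼ∈K x x∉B = trans (combination-unitVector I cols j x) (trans (cong (I x) colⱼ≡B) x∉B)
        eⱼ,ᵢ≡false : eⱼ i ≡ false
        eⱼ,ᵢ≡false = updateAt-minimal i j (λ _ → false) (λ i≡j → punchInᵢ≢i i l (sym i≡j))

      residual-cols : Fin n → Σ (Fin b) (λ j → j ≢ B)
      residual-cols l = cols (punchIn i l) , column≢B l

      residual-ind : ColsIndependent (ResidualIncidence I B) residual-cols
      residual-ind c'' comb≡0 l =
        trans (sym (insertAt-punchIn c'' i false l)) (pivot c c∈K cᵢ≡false (punchIn i l))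
        where
        c = insertAt c'' i false
        cᵢ≡false : c i ≡ false
        cᵢ≡false = insertAt-lookup c'' i false
        c∈K : InKernel c
        c∈K x x∉B = begin
          combination I cols c x
            ≡⟨ combination-removeAt I cols {c} i cᵢ≡false x ⟩
          combination I (removeAt cols i) (removeAt c i) x
            ≡⟨ combination-cong I (removeAt cols i) (insertAt-punchIn c'' i false) x ⟩
          combination I (removeAt cols i) c'' x
            ≡⟨ comb≡0 (x , x∉B) ⟩
          false ∎

  residual-restrict : VanishingCombinationsZeroOrColumn I B →
    ∀ {n} → Independent I (suc (suc n)) → ¬ ¬ Independent (ResidualIncidence I B) (suc n)
  residual-restrict zero-or-B (cols , ind) no-ind =
    pivot-exists λ (i , pivot) → no-ind (residual-removeAt pivot)
    where open ResidualRestriction zero-or-B cols ind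

_⊆_ : ∀ {n} → (Fin n → Bool) → (Fin n → Bool) → Set
g ⊆ h = ∀ x → g x ≡ true → h x ≡ true

card-mono : ∀ {n} {g h : Fin n → Bool} → g ⊆ h → card g ≤ card h
card-mono {zero}          g⊆h = z≤n
card-mono {suc n} {g} {h} g⊆h with g zero in g₀ | h zero in h₀
... | true  | true  = s≤s (card-mono (g⊆h ∘ suc))
... | false | true  = m≤n⇒m≤1+n (card-mono (g⊆h ∘ suc))
... | false | false = card-mono (g⊆h ∘ suc)
... | true  | false = contradiction (trans (sym (g⊆h zero g₀)) h₀) λ ()

card-mono-< : ∀ {n} {g h : Fin n → Bool} → g ⊆ h → ∀ {x} → g x ≡ false → h x ≡ true → card g < card h
card-mono-< {suc n} {g} {h} g⊆h {zero} gₓ hₓ rewrite gₓ | hₓ = s≤s (card-mono (g⊆h ∘ suc))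
card-mono-< {suc n} {g} {h} g⊆h {suc x} gₓ hₓ with g zero in g₀ | h zero in h₀
... | true  | true  = s≤s (card-mono-< (g⊆h ∘ suc) gₓ hₓ)
... | false | true  = m<n⇒m<1+n (card-mono-< (g⊆h ∘ suc) gₓ hₓ)
... | false | false = card-mono-< (g⊆h ∘ suc) gₓ hₓ
... | true  | false = contradiction (trans (sym (g⊆h zero g₀)) h₀) λ ()

⊆∧card≡⇒≗ : ∀ {n} {g h : Fin n → Bool} → g ⊆ h → card g ≡ card h → g ≗ h
⊆∧card≡⇒≗ {g = g} g⊆h card≡ x with g x in gₓ
... | true  = sym (g⊆h x gₓ)
... | false = sym (¬-not λ hₓ → <⇒≢ (card-mono-< g⊆h gₓ hₓ) card≡)

card-not+card : ∀ {n} (g : Fin n → Bool) → card (not ∘ g) + card g ≡ n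
card-not+card {zero}  g = refl
card-not+card {suc n} g with g zero
... | true  = trans (+-suc _ _) (cong suc (card-not+card (g ∘ suc)))
... | false = cong suc (card-not+card (g ∘ suc))

0<card⇒∃ : ∀ {n} (g : Fin n → Bool) → 0 < card g → Σ (Fin n) λ x → g x ≡ true
0<card⇒∃ {suc n} g 0<card with g zero in g₀
... | true  = zero , g₀
... | false with 0<card⇒∃ (g ∘ suc) 0<card
...   | x , gₓ = suc x , gₓ

-- φ ranges over all four maps Bool → Bool, i.e. all GF(2)-affine maps, so this says
-- f ∈ C + span{B, 𝟏} for some block C.
InBlockCoset : ∀ {v b} → Incidence v b → Fin b → (Fin v → Bool) → Set
InBlockCoset {b = b} I B f = Σ (Fin b) λ C → Σ (Bool → Bool) λ φ → ∀ x → f x ≡ I x C xor φ (I x B)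

xor-shift-coset : ∀ b c d e u w → b xor (c xor d) ≡ u xor e → d xor (c xor w) ≡ e xor (u xor (b xor w))
xor-shift-coset b c d e u w b+c+d≡u+e = begin
  d xor (c xor w)                 ≡⟨ xor-assoc d c w ⟨
  (d xor c) xor w                 ≡⟨ cong (_xor w) (xor-comm d c) ⟩
  (c xor d) xor w                 ≡⟨ xor-xor-cancelˡ b (c xor d) w ⟨
  (b xor (c xor d)) xor (b xor w) ≡⟨ cong (_xor (b xor w)) b+c+d≡u+e ⟩
  (u xor e) xor (b xor w)         ≡⟨ cong (_xor (b xor w)) (xor-comm u e) ⟩
  (e xor u) xor (b xor w)         ≡⟨ xor-assoc e u (b xor w) ⟩
  e xor (u xor (b xor w))         ∎
  where open ≡-Reasoning

module _ {v b} {I : Incidence v b} (sdp : SDPCondition I) (B : Fin b) where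

  sdp-xor : ∀ C D → Σ (Fin b) λ E → Σ Bool λ u → ∀ x → I x B xor (I x C xor I x D) ≡ u xor I x E
  sdp-xor C D with sdp B C D
  ... | inj₁ (E , B+C+D≡E)  = E , false , B+C+D≡E
  ... | inj₂ (E , B+C+D≡¬E) = E , true , B+C+D≡¬E

  combination-inBlockCoset : ∀ {n} (cols : Fin n → Fin b) c → InBlockCoset I B (combination I cols c)
  combination-inBlockCoset {zero} cols c = B , (λ β → β) , λ x → sym (xor-same (I x B))
  combination-inBlockCoset {suc n} cols c with c zero | combination-inBlockCoset (tail cols) (tail c)
  ... | false | coset = coset
  ... | true  | C , φ , f≡C+φB with sdp-xor C (cols zero)
  ...   | E , u , B+C+D≡u+E = E , (λ β → u xor (β xor φ β)) , λ x →
    trans (cong (I x (cols zero) xor_) (f≡C+φB x))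
          (xor-shift-coset (I x B) (I x C) (I x (cols zero)) (I x E) u (φ (I x B)) (B+C+D≡u+E x))

xor-self-image : ∀ {φ : Bool → Bool} → φ false ≡ false → ∀ β → β xor φ β ≡ β ∧ not (φ true)
xor-self-image φ₀ false = φ₀
xor-self-image φ₀ true  = refl

∧-not-zero⊎identity : ∀ γ → (∀ β → β ∧ not γ ≡ false) ⊎ (∀ β → β ∧ not γ ≡ β)
∧-not-zero⊎identity true  = inj₁ ∧-zeroʳ
∧-not-zero⊎identity false = inj₂ ∧-identityʳ

module _ {v b k} {I : Incidence v b} (block-size : ∀ j → card (λ x → I x j) ≡ k) where

  block-⊆⇒≗ : ∀ C D → (λ x → I x C) ⊆ (λ x → I x D) → ∀ x → I x C ≡ I x D
  block-⊆⇒≗ C D C⊆D = ⊆∧card≡⇒≗ C⊆D (trans (block-size C) (sym (block-size D)))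

  complement-⊈-block : k + k < v → ∀ C D → ¬ ((λ x → not (I x D)) ⊆ (λ x → I x C))
  complement-⊈-block k+k<v C D ∁D⊆C = <⇒≱ k+k<v (begin
    v                                             ≡⟨ card-not+card (λ x → I x D) ⟨
    card (λ x → not (I x D)) + card (λ x → I x D) ≤⟨ +-monoˡ-≤ _ (card-mono ∁D⊆C) ⟩
    card (λ x → I x C) + card (λ x → I x D)       ≡⟨ cong₂ _+_ (block-size C) (block-size D) ⟩
    k + k                                         ∎)
    where open ≤-Reasoning

  module VanishingCoset (k+k<v : k + k < v) {B C : Fin b} {φ : Bool → Bool} {f : Fin v → Bool}
    (f≡C+φB : ∀ x → f x ≡ I x C xor φ (I x B)) (f-vanishes : VanishesOff I B f) where
    open ≡-Reasoning

    C≡φfalse-offB : ∀ x → I x B ≡ false → I x C ≡ φ false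
    C≡φfalse-offB x x∉B = xor≡false⇒≡ (begin
      I x C xor φ false   ≡⟨ cong (λ β → I x C xor φ β) x∉B ⟨
      I x C xor φ (I x B) ≡⟨ f≡C+φB x ⟨
      f x                 ≡⟨ f-vanishes x x∉B ⟩
      false               ∎)

    φfalse≡false : φ false ≡ false
    φfalse≡false = ¬-not λ φ₀≡true → complement-⊈-block k+k<v C B λ x ¬B∋x →
      trans (C≡φfalse-offB x (trans (sym (not-involutive (I x B))) (cong not ¬B∋x))) φ₀≡true

    C⊆B : (λ x → I x C) ⊆ (λ x → I x B)
    C⊆B x C∋x = ¬-not λ x∉B →
      contradiction (trans (sym C∋x) (trans (C≡φfalse-offB x x∉B) φfalse≡false)) λ ()

    f≡B∧¬φtrue : ∀ x → f x ≡ I x B ∧ not (φ true)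
    f≡B∧¬φtrue x = begin
      f x                  ≡⟨ f≡C+φB x ⟩
      I x C xor φ (I x B)  ≡⟨ cong (_xor φ (I x B)) (block-⊆⇒≗ C B C⊆B x) ⟩
      I x B xor φ (I x B)  ≡⟨ xor-self-image {φ} φfalse≡false (I x B) ⟩
      I x B ∧ not (φ true) ∎

  inBlockCoset∧vanishesOff⇒zeroOrColumn : k + k < v → ∀ B {f} →
    InBlockCoset I B f → VanishesOff I B f → ZeroOrColumn I B f
  inBlockCoset∧vanishesOff⇒zeroOrColumn k+k<v B (C , φ , f≡C+φB) f-vanishes =
    Sum.map (λ ≡false x → trans (f≡B∧¬φtrue x) (≡false (I x B)))
            (λ ≡B x → trans (f≡B∧¬φtrue x) (≡B (I x B)))
            (∧-not-zero⊎identity (φ true))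
    where open VanishingCoset k+k<v {φ = φ} f≡C+φB f-vanishes

sdpBlockSize : ℕ → ℕ
sdpBlockSize m = 2 ^ (2 * m ∸ 1) ∸ 2 ^ (m ∸ 1)

2^[m∸1]<2^[2m∸1] : ∀ m → 1 ≤ m → 2 ^ (m ∸ 1) < 2 ^ (2 * m ∸ 1)
2^[m∸1]<2^[2m∸1] (suc m') _ = ^-monoʳ-< 2 (s≤s (s≤s z≤n)) (m<m+n m' (s≤s z≤n))

sdpBlockSize-positive : ∀ m → 1 ≤ m → 0 < sdpBlockSize m
sdpBlockSize-positive m 1≤m = m<n⇒0<n∸m (2^[m∸1]<2^[2m∸1] m 1≤m)

sdpBlockSize-doubled< : ∀ m → 1 ≤ m → sdpBlockSize m + sdpBlockSize m < 2 ^ (2 * m)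
sdpBlockSize-doubled< m@(suc m') 1≤m = begin-strict
  sdpBlockSize m + sdpBlockSize m <⟨ +-mono-< k<half k<half ⟩
  half + half                     ≡⟨ cong (half +_) (+-identityʳ half) ⟨
  2 ^ (2 * m)                     ∎
  where
  open ≤-Reasoning
  half = 2 ^ (2 * m ∸ 1)
  k<half : sdpBlockSize m < half
  k<half = ∸-monoʳ-< (m^n>0 2 m') (<⇒≤ (2^[m∸1]<2^[2m∸1] m 1≤m))

theorem2p3 : (m : ℕ) → 1 ≤ m → (I : Incidence (2 ^ (2 * m)) (2 ^ (2 * m))) →
    IsSymmetricSDP m I → (B : Fin (2 ^ (2 * m))) → LinearlyEmbeddable₂ I B
theorem2p3 m 1≤m I ((block-size , _) , sdp) B r r'' =
  rank₂-≡-suc I (ResidualIncidence I B)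
    (residual-extend I B (proj₂ B-nonempty))
    (residual-restrict I B λ cols c →
      inBlockCoset∧vanishesOff⇒zeroOrColumn block-size (sdpBlockSize-doubled< m 1≤m) B
        (combination-inBlockCoset sdp B cols c))
  where
  B-nonempty : Σ (Fin (2 ^ (2 * m))) λ x → I x B ≡ true
  B-nonempty = 0<card⇒∃ (λ x → I x B) (subst (0 <_) (sym (block-size B)) (sdpBlockSize-positive m 1≤m))
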